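{- Let $G\in\mathcal{C}_{n,m}$. For each $k\in\{1,2,\ldots,n\}$ and each $i\in\{0,1,\ldots,m\}$, \[ N_i^{(k)}(G)=\sum_{j=\max\{1,n-i\}}^{k}\frac{1}{(j-1)!\,(i-n+j)!}\,\frac{\partial^{2j+i-n-1}W_G}{\partial x^{j-1}\,\partial y^{i-n+j}}(0,0), \] where an empty sum is $0$.
   Context: $\mathcal{C}_{n,m}$ denotes the set of all connected simple graphs on $n$ vertices and $m$ edges. For a graph on $n$ vertices with $e$ edges and $\kappa$ connected components, its rank is $n-\kappa$ and its corank is $e-n+\kappa$; write $r(\cdot)$, $c(\cdot)$. $\mathcal{S}(G)$ is the set of spanning subgraphs of $G$. The Whitney polynomial is $W_G(x,y)=\sum_{H\in\mathcal{S}(G)}x^{r(G)-r(H)}y^{c(H)}$. $N_i^{(k)}(G)$ is the number of spanning subgraphs of $G$ having exactly $i$ edges and at most $k$ connected components. -}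

module Defs where

open import Data.Nat as ℕ using (ℕ; zero; suc; _+_; _*_; _∸_; _⊔_; _≤_; _!)
open import Data.Nat.Properties using (_!*_!≢0)
open import Data.Bool using (Bool; true; false; _∧_; _∨_; not)
open import Data.Fin as Fin using (Fin; toℕ)
open import Data.Product using (_×_; _,_; proj₁; proj₂)
open import Data.List using (List; []; _∷_; _++_; map; length; foldr; filterᵇ; applyUpTo; allFin)
open import Data.Bool.ListAction using (any; all)
open import Data.List.Relation.Unary.All using (All)
open import Data.List.Relation.Unary.Unique.Propositional using (Unique)
open import Relation.Nullary.Decidable using (⌊_⌋)
open import Data.Integer using (+_)
open import Data.Rational as ℚ using (ℚ; 0ℚ)
open import Function using (_∘_)
open import Relation.Binary.PropositionalEquality using (_≡_)

-- An edge is a pair (u , v) with toℕ u < toℕ v (so no loops, and each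
-- unordered pair has a unique representation); edges are pairwise
-- distinct (no multiple edges).

Edge : ℕ → Set
Edge n = Fin n × Fin n

record Graph (n : ℕ) : Set where
  field
    edges  : List (Edge n)
    simple : All (λ e → toℕ (proj₁ e) ℕ.< toℕ (proj₂ e)) edges
    nodup  : Unique edges
open Graph public

_==_ : ∀ {n} → Fin n → Fin n → Bool
u == v = ⌊ u Fin.≟ v ⌋

iter : {A : Set} → ℕ → (A → A) → A → A
iter zero    f a = a
iter (suc k) f a = f (iter k f a)

step : ∀ {n} → List (Edge n) → (Fin n → Bool) → (Fin n → Bool)
step es R v = R v ∨ any (λ e → (R (proj₁ e) ∧ (proj₂ e == v)) ∨ (R (proj₂ e) ∧ (proj₁ e == v))) es

-- reach es u v = true iff v is joined to u by a path (paths have < n edges,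
-- so n closure steps suffice)
reach : ∀ {n} → List (Edge n) → Fin n → Fin n → Bool
reach {n} es u = iter n (step es) (u ==_)

-- a vertex is a representative of its component iff it is the least
-- vertex of that component; κ counts the components
isRep : ∀ {n} → List (Edge n) → Fin n → Bool
isRep {n} es v = all (λ u → not (⌊ toℕ u ℕ.<? toℕ v ⌋ ∧ reach es v u)) (allFin n)

κ : ∀ {n} → List (Edge n) → ℕ
κ {n} es = length (filterᵇ (isRep es) (allFin n))

rank : ∀ {n} → List (Edge n) → ℕ
rank {n} es = n ∸ κ es

corank : ∀ {n} → List (Edge n) → ℕ
corank {n} es = (length es + κ es) ∸ n

Connected : ∀ {n} → Graph n → Set
Connected G = κ (edges G) ≡ 1

InC : (n m : ℕ) → Graph n → Set
InC n m G = Connected G × (length (edges G) ≡ m)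

-- Spanning subgraphs: all sub-lists of the edge list (each subset of
-- the edge set exactly once, since edges are distinct).

sublists : {A : Set} → List A → List (List A)
sublists []       = [] ∷ []
sublists (x ∷ xs) = map (x ∷_) (sublists xs) ++ sublists xs

spanning : ∀ {n} → Graph n → List (List (Edge n))
spanning G = sublists (edges G)

-- Bivariate polynomials in x, y with integer (here ℕ) coefficients,
-- represented by their coefficient function: p a b = coeff of x^a y^b.

Poly : Set
Poly = ℕ → ℕ → ℕ

0P : Poly
0P a b = 0

_⊕_ : Poly → Poly → Poly
(p ⊕ q) a b = p a b + q a b

mono : ℕ → ℕ → Poly
mono i j a b = if⌊ i , j , a , b ⌋
  where
  if⌊_⌋ : ℕ × ℕ × ℕ × ℕ → ℕ
  if⌊ i , j , a , b ⌋ with ⌊ i ℕ.≟ a ⌋ ∧ ⌊ j ℕ.≟ b ⌋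
  ... | true  = 1
  ... | false = 0

∂x : Poly → Poly
∂x p a b = suc a * p (suc a) b

∂y : Poly → Poly
∂y p a b = suc b * p a (suc b)

∂xy : ℕ → ℕ → Poly → Poly
∂xy s t p = iter s ∂x (iter t ∂y p)

at00 : Poly → ℕ
at00 p = p 0 0

whitney : ∀ {n} → Graph n → Poly
whitney G = foldr (λ H acc → mono (rank (edges G) ∸ rank H) (corank H) ⊕ acc) 0P (spanning G)

N : ℕ → ℕ → ∀ {n} → Graph n → ℕ
N i k G = length (filterᵇ (λ H → ⌊ length H ℕ.≟ i ⌋ ∧ ⌊ κ H ℕ.≤? k ⌋) (spanning G))

-- Summation over the integer interval [a, b] (empty if b < a), in ℚ

range : ℕ → ℕ → List ℕ
range a b = applyUpTo (λ t → a + t) (suc b ∸ a)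

Σℚ[_≤j≤_] : ℕ → ℕ → (ℕ → ℚ) → ℚ
Σℚ[ a ≤j≤ b ] f = foldr (λ j acc → f j ℚ.+ acc) 0ℚ (range a b)

divFact : ℕ → ℕ → ℕ → ℚ
divFact d s t = ℚ._/_ (+ d) (s ! * t !) {{s !* t !≢0}}

rhs : ∀ (n i k : ℕ) → Graph n → ℚ
rhs n i k G =
  Σℚ[ 1 ⊔ (n ∸ i) ≤j≤ k ] λ j →
    divFact (at00 (∂xy (j ∸ 1) (i + j ∸ n) (whitney G))) (j ∸ 1) (i + j ∸ n)

{-# OPTIONS --safe #-}
-- For connected G on n vertices, r(G) − r(H) = κ(H) − 1 and c(H) = |H| + κ(H) − n, so the
-- coefficient of x^(j−1) y^(i+j−n) in W_G counts the spanning subgraphs with i edges and j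
-- components, and the divided derivative at (0,0) is exactly that coefficient. A subgraph with
-- i edges has at least max(1, n − i) components, so summing over j up to k counts those with at
-- most k components. The graph-theoretic input is n ≤ |H| + κ(H) (an edge merges at most two
-- components), which makes the truncated subtraction in the corank exact. Since κ counts the
-- vertices that are least in their reach-closure, the first step is that reach is path-connectivity.
module Submission where

open import Defs
open import Data.Nat as ℕ
  using (ℕ; zero; suc; _+_; _*_; _∸_; _⊔_; _≤_; _<_; z≤n; s≤s; _≟_; _≤?_; _!; NonZero)
import Data.Nat.Properties as ℕ
open import Algebra.Properties.CommutativeSemigroup ℕ.+-commutativeSemigroup using (interchange)
open import Data.Bool as Bool using (Bool; true; false; T; T?; not; _∧_; _∨_)
open import Data.Bool.Properties using (T-∧; T-∨; T-≡; T-not-≡)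
open import Data.Fin as Fin using (Fin; toℕ)
open import Data.Fin.Properties using (toℕ-injective; toℕ-fromℕ<; all?; ¬∀⟶∃¬)
open import Data.Product using (_×_; _,_; proj₁; proj₂; ∃-syntax)
open import Data.Sum as Sum using (_⊎_; inj₁; inj₂)
open import Data.Empty using (⊥-elim)
open import Data.Unit using (tt)
open import Data.List using (List; []; _∷_; length; map; foldr; filterᵇ; allFin)
open import Data.Bool.ListAction using (all)
open import Data.Nat.ListAction using (sum)
open import Data.List.Properties
  using (length-filter; filter-all; filter-some; length-tabulate; map-cong; map-cong-local)
open import Data.List.Relation.Unary.All as All using (All; []; _∷_)
open import Data.List.Relation.Unary.All.Properties using (all⁺; all⁻; All¬⇒¬Any; ¬All⇒Any¬)
open import Data.List.Relation.Unary.Any using (Any; here; there)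
open import Data.List.Relation.Unary.Any.Properties using (any⁺; any⁻)
open import Data.List.Relation.Unary.AllPairs using ([]; _∷_)
open import Data.List.Relation.Unary.Unique.Propositional using (Unique)
open import Data.List.Relation.Unary.Unique.Propositional.Properties using (allFin⁺; applyUpTo⁺₁)
open import Data.List.Membership.Propositional using (_∈_; find; lose)
open import Data.List.Membership.Propositional.Properties using (∈-allFin; ∈-applyUpTo⁺; ∈-applyUpTo⁻)
open import Data.List.Membership.DecPropositional ℕ._≟_ using (_∈?_)
open import Data.Integer as ℤ using (+_)
import Data.Integer.Properties as ℤ
open import Data.Rational as ℚ using (ℚ; 0ℚ; _/_)
import Data.Rational.Properties as ℚ
open import Data.Rational.Unnormalised using (mkℚᵘ; *≡*)
import Data.Nat.Coprimality as Coprime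
open import Function using (id; _∘_; _⇔_; mk⇔; Equivalence)
open import Relation.Binary.Construct.Closure.ReflexiveTransitive as Star using (Star; ε; _◅_; _◅◅_)
open import Relation.Nullary using (¬_; Dec; yes; no; contradiction)
open import Relation.Nullary.Decidable
  using (⌊_⌋; toWitness; fromWitness; isYes≗does; does-⇔; dec-true; dec-false)
open import Relation.Binary.PropositionalEquality

open Equivalence using (to; from)

private
  variable
    A B : Set

ind : Bool → ℕ
ind true  = 1
ind false = 0

T-⇔→≡ : ∀ {a b} → T a ⇔ T b → a ≡ b
T-⇔→≡ {false} {false} _   = refl
T-⇔→≡ {false} {true}  a⇔b = ⊥-elim (from a⇔b tt)
T-⇔→≡ {true}  {false} a⇔b = ⊥-elim (to a⇔b tt)
T-⇔→≡ {true}  {true}  _   = refl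

T-≢-above : ∀ {a b} → (T a → T b) → b ≢ a → T b × ¬ T a
T-≢-above {false} {false} _   b≢a = contradiction refl b≢a
T-≢-above {false} {true}  _   _   = tt , λ ()
T-≢-above {true}  {false} a⇒b _   = ⊥-elim (a⇒b tt)
T-≢-above {true}  {true}  _   b≢a = contradiction refl b≢a

¬T⇒T-not : ∀ {b} → ¬ T b → T (not b)
¬T⇒T-not {false} _  = tt
¬T⇒T-not {true}  ¬t = ¬t tt

¬T-not⇒T : ∀ {b} → ¬ T (not b) → T b
¬T-not⇒T {false} ¬t = ¬t tt
¬T-not⇒T {true}  _  = tt

¬all⇒∃ : ∀ (p : A → Bool) xs → ¬ T (all p xs) → ∃[ x ] x ∈ xs × ¬ T (p x)
¬all⇒∃ p xs ¬all = find (¬All⇒Any¬ (T? ∘ p) xs (¬all ∘ all⁻ p))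

⌊⌋-true : (a? : Dec A) → A → ⌊ a? ⌋ ≡ true
⌊⌋-true a? a = trans (isYes≗does a?) (dec-true a? a)

⌊⌋-false : (a? : Dec A) → ¬ A → ⌊ a? ⌋ ≡ false
⌊⌋-false a? ¬a = trans (isYes≗does a?) (dec-false a? ¬a)

⌊⌋-⇔ : (a? : Dec A) (b? : Dec B) → A ⇔ B → ⌊ a? ⌋ ≡ ⌊ b? ⌋
⌊⌋-⇔ a? b? A⇔B = trans (isYes≗does a?) (trans (does-⇔ A⇔B a? b?) (sym (isYes≗does b?)))

count : (A → Bool) → List A → ℕ
count p xs = length (filterᵇ p xs)

count-mono : ∀ (p q : A → Bool) {xs} → (∀ {x} → x ∈ xs → T (p x) → T (q x)) →
             count p xs ≤ count q xs
count-mono p q {[]}     _   = z≤n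
count-mono p q {x ∷ xs} p⇒q with p x in px | q x in qx
... | true  | true  = s≤s (count-mono p q (p⇒q ∘ there))
... | true  | false = ⊥-elim (subst T qx (p⇒q (here refl) (from T-≡ px)))
... | false | true  = ℕ.m≤n⇒m≤1+n (count-mono p q (p⇒q ∘ there))
... | false | false = count-mono p q (p⇒q ∘ there)

count-mono-< : ∀ (p q : A → Bool) {xs v} → (∀ {x} → x ∈ xs → T (p x) → T (q x)) →
               v ∈ xs → ¬ T (p v) → T (q v) → count p xs < count q xs
count-mono-< p q {x ∷ xs} p⇒q (here refl) ¬pv qv with p x | q x
... | true  | _     = ⊥-elim (¬pv tt)
... | false | true  = s≤s (count-mono p q (p⇒q ∘ there))
... | false | false = ⊥-elim qv
count-mono-< p q {x ∷ xs} p⇒q (there v∈xs) ¬pv qv with p x in px | q x in qx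
... | true  | true  = s≤s (count-mono-< p q (p⇒q ∘ there) v∈xs ¬pv qv)
... | true  | false = ⊥-elim (subst T qx (p⇒q (here refl) (from T-≡ px)))
... | false | true  = ℕ.m<n⇒m<1+n (count-mono-< p q (p⇒q ∘ there) v∈xs ¬pv qv)
... | false | false = count-mono-< p q (p⇒q ∘ there) v∈xs ¬pv qv

count-≤-suc : ∀ (p q : A → Bool) {xs} → Unique xs →
              (∀ {x y} → T (q x) → ¬ T (p x) → T (q y) → ¬ T (p y) → x ≡ y) →
              count q xs ≤ suc (count p xs)
count-≤-suc p q []               _   = z≤n
count-≤-suc p q {x ∷ xs} (x∉xs ∷ u) one with p x in px | q x in qx
... | true  | true  = s≤s (count-≤-suc p q u one)
... | true  | false = ℕ.m≤n⇒m≤1+n (count-≤-suc p q u one)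
... | false | false = count-≤-suc p q u one
... | false | true  = s≤s (count-mono q p q⇒p)
  where
  q⇒p : ∀ {y} → y ∈ xs → T (q y) → T (p y)
  q⇒p {y} y∈xs qy with p y in py
  ... | true  = tt
  ... | false = ⊥-elim (All.lookup x∉xs y∈xs
                  (one (from T-≡ qx) (λ t → subst T px t) qy (λ t → subst T py t)))

count-as-sum : ∀ (p : A → Bool) xs → count p xs ≡ sum (map (ind ∘ p) xs)
count-as-sum p []       = refl
count-as-sum p (x ∷ xs) with p x
... | true  = cong suc (count-as-sum p xs)
... | false = count-as-sum p xs

sum-map-cong-∈ : ∀ {f g : A → ℕ} {xs} → (∀ {x} → x ∈ xs → f x ≡ g x) →
                 sum (map f xs) ≡ sum (map g xs)
sum-map-cong-∈ f≡g = cong sum (map-cong-local (All.tabulate f≡g))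

sum-map-zero : ∀ {f : A → ℕ} {xs} → (∀ {x} → x ∈ xs → f x ≡ 0) → sum (map f xs) ≡ 0
sum-map-zero {xs = []}     _    = refl
sum-map-zero {xs = x ∷ xs} f≡0 = cong₂ _+_ (f≡0 (here refl)) (sum-map-zero (f≡0 ∘ there))

sum-map-+ : ∀ (f g : A → ℕ) xs → sum (map f xs) + sum (map g xs) ≡ sum (map (λ x → f x + g x) xs)
sum-map-+ f g []       = refl
sum-map-+ f g (x ∷ xs) =
  trans (interchange (f x) (sum (map f xs)) (g x) (sum (map g xs)))
        (cong (_+_ (f x + g x)) (sum-map-+ f g xs))

sum-map-swap : ∀ (F : A → B → ℕ) xs ys →
               sum (map (λ x → sum (map (F x) ys)) xs) ≡ sum (map (λ y → sum (map (λ x → F x y) xs)) ys)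
sum-map-swap F []       ys = sym (sum-map-zero {xs = ys} (λ _ → refl))
sum-map-swap F (x ∷ xs) ys =
  trans (cong (_+_ (sum (map (F x) ys))) (sum-map-swap F xs ys))
        (sum-map-+ (F x) (λ y → sum (map (λ x′ → F x′ y) xs)) ys)

sum-map-≟ : ∀ c {xs} → Unique xs → sum (map (λ x → ind ⌊ c ≟ x ⌋) xs) ≡ ind ⌊ c ∈? xs ⌋
sum-map-≟ c []                          = refl
sum-map-≟ c {x ∷ xs} (x∉xs ∷ u) with c ≟ x
... | yes refl = begin
  suc (sum (map (λ x → ind ⌊ c ≟ x ⌋) xs)) ≡⟨ cong suc (sum-map-≟ c u) ⟩
  suc (ind ⌊ c ∈? xs ⌋)                    ≡⟨ cong (suc ∘ ind) (⌊⌋-false (c ∈? xs) (All¬⇒¬Any x∉xs)) ⟩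
  1                                        ∎
  where open ≡-Reasoning
... | no c≢x = trans (sum-map-≟ c u) (cong ind (⌊⌋-⇔ (c ∈? xs) _ (mk⇔ there ∈-tail)))
  where
  ∈-tail : c ∈ x ∷ xs → c ∈ xs
  ∈-tail (here c≡x)  = contradiction c≡x c≢x
  ∈-tail (there c∈xs) = c∈xs

module _ {a b : ℕ} where

  range-unique : Unique (range a b)
  range-unique = applyUpTo⁺₁ (_+_ a) (suc b ∸ a) (λ s<t _ → ℕ.<⇒≢ s<t ∘ ℕ.+-cancelˡ-≡ a _ _)

  ∈-range⁻ : ∀ {c} → c ∈ range a b → a ≤ c × c ≤ b
  ∈-range⁻ c∈ with t , t<len , refl ← ∈-applyUpTo⁻ (_+_ a) c∈ = ℕ.m≤m+n a t , ℕ.s≤s⁻¹ a+t<1+b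
    where
    a≤1+b : a ≤ suc b
    a≤1+b = ℕ.<⇒≤ (ℕ.m∸n≢0⇒n<m (λ len≡0 → ℕ.n≮0 (subst (t <_) len≡0 t<len)))
    a+t<1+b : a + t < suc b
    a+t<1+b = subst (a + t <_) (ℕ.m+[n∸m]≡n a≤1+b) (ℕ.+-monoʳ-< a t<len)

  ∈-range⁺ : ∀ {c} → a ≤ c → c ≤ b → c ∈ range a b
  ∈-range⁺ {c} a≤c c≤b =
    subst (_∈ range a b) (ℕ.m+[n∸m]≡n a≤c) (∈-applyUpTo⁺ (_+_ a) (ℕ.∸-monoˡ-< (s≤s c≤b) a≤c))

-- Iterating an inflationary operator on subsets of Fin n

size : ∀ {n} → (Fin n → Bool) → ℕ
size {n} Q = count Q (allFin n)

size≤n : ∀ {n} (Q : Fin n → Bool) → size Q ≤ n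
size≤n {n} Q = ℕ.≤-trans (length-filter (T? ∘ Q) (allFin n)) (ℕ.≤-reflexive (length-tabulate id))

module Closure {n : ℕ} (f : (Fin n → Bool) → (Fin n → Bool))
  (inflationary : ∀ Q {v} → T (Q v) → T (f Q v))
  (congruent : ∀ {Q Q′} → Q ≗ Q′ → f Q ≗ f Q′)
  where

  fixed-or-grows : ∀ Q → f Q ≗ Q ⊎ size Q < size (f Q)
  fixed-or-grows Q with all? (λ v → f Q v Bool.≟ Q v)
  ... | yes fixed = inj₁ fixed
  ... | no ¬fixed =
    let v , fQv≢Qv = ¬∀⟶∃¬ n _ (λ v → f Q v Bool.≟ Q v) ¬fixed
        fQv , ¬Qv  = T-≢-above (inflationary Q) fQv≢Qv
    in  inj₂ (count-mono-< Q (f Q) (λ _ → inflationary Q) (∈-allFin v) ¬Qv fQv)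

  iter-fixed-or-large : ∀ Q k → f (iter k f Q) ≗ iter k f Q ⊎ k + size Q ≤ size (iter k f Q)
  iter-fixed-or-large Q zero = inj₂ ℕ.≤-refl
  iter-fixed-or-large Q (suc k) with iter-fixed-or-large Q k
  ... | inj₁ fixed = inj₁ (congruent fixed)
  ... | inj₂ large with fixed-or-grows (iter k f Q)
  ...   | inj₁ fixed = inj₁ (congruent fixed)
  ...   | inj₂ grows = inj₂ (ℕ.≤-trans (s≤s large) grows)

  -- a nonempty subset of Fin n can grow only n ∸ 1 times
  iter-fixed : ∀ Q → 0 < size Q → f (iter n f Q) ≗ iter n f Q
  iter-fixed Q nonempty with iter-fixed-or-large Q n
  ... | inj₁ fixed = fixed
  ... | inj₂ large = contradiction
    (ℕ.≤-trans (ℕ.+-monoʳ-≤ n nonempty) (ℕ.≤-trans large (size≤n _)))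
    (ℕ.m+1+n≰m n)

  iter-inflationary : ∀ Q k {v} → T (Q v) → T (iter k f Q v)
  iter-inflationary Q zero    Qv = Qv
  iter-inflationary Q (suc k) Qv = inflationary (iter k f Q) (iter-inflationary Q k Qv)

-- Paths, reachability and components

module _ {n : ℕ} where

  Adjacent : List (Edge n) → Fin n → Fin n → Set
  Adjacent es x y = (x , y) ∈ es ⊎ (y , x) ∈ es

  Path : List (Edge n) → Fin n → Fin n → Set
  Path es = Star (Adjacent es)

  Path-sym : ∀ {es x y} → Path es x y → Path es y x
  Path-sym = Star.reverse Sum.swap

  Path-[] : ∀ {x y} → Path [] x y → x ≡ y
  Path-[] ε              = refl
  Path-[] (inj₁ () ◅ _)
  Path-[] (inj₂ () ◅ _)

  ==-refl : ∀ (u : Fin n) → T (u == u)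
  ==-refl u = fromWitness refl

  ==⇒≡ : ∀ {u v : Fin n} → T (u == v) → u ≡ v
  ==⇒≡ {u} {v} = toWitness {a? = u Fin.≟ v}

  step-inflationary : ∀ es Q {v : Fin n} → T (Q v) → T (step es Q v)
  step-inflationary es Q Qv = from T-∨ (inj₁ Qv)

  step-adjacent : ∀ {es Q} {x v : Fin n} → T (Q x) → Adjacent es x v → T (step es Q v)
  step-adjacent {es} {Q} {x} {v} Qx adj = from T-∨ (inj₂ (any⁺ _ (via adj)))
    where
    via : Adjacent es x v →
          Any (λ e → T ((Q (proj₁ e) ∧ (proj₂ e == v)) ∨ (Q (proj₂ e) ∧ (proj₁ e == v)))) es
    via (inj₁ xv∈es) = lose xv∈es (from T-∨ (inj₁ (from T-∧ (Qx , ==-refl v))))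
    via (inj₂ vx∈es) = lose vx∈es (from T-∨ (inj₂ (from T-∧ (Qx , ==-refl v))))

  step-source : ∀ {es Q} {v : Fin n} → T (step es Q v) → T (Q v) ⊎ ∃[ x ] T (Q x) × Adjacent es x v
  step-source {es} {Q} {v} t with to (T-∨ {Q v}) t
  ... | inj₁ Qv = inj₁ Qv
  ... | inj₂ t′ with (a , b) , ab∈es , hit ← find (any⁻ _ es t′) with to T-∨ hit
  ...   | inj₁ a→v with Qa , b==v ← to T-∧ a→v with refl ← ==⇒≡ {b} {v} b==v =
    inj₂ (a , Qa , inj₁ ab∈es)
  ...   | inj₂ b→v with Qb , a==v ← to T-∧ b→v with refl ← ==⇒≡ {a} {v} a==v =
    inj₂ (b , Qb , inj₂ ab∈es)

  step-mono : ∀ {es Q Q′} → (∀ {x} → T (Q x) → T (Q′ x)) → ∀ {v} → T (step es Q v) → T (step es Q′ v)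
  step-mono {es} {Q} {Q′} Q⇒Q′ {v} t with step-source {es} {Q} {v} t
  ... | inj₁ Qv             = step-inflationary es Q′ (Q⇒Q′ Qv)
  ... | inj₂ (x , Qx , adj) = step-adjacent {es} {Q′} (Q⇒Q′ Qx) adj

  step-cong : ∀ es {Q Q′} → Q ≗ Q′ → step es Q ≗ step es Q′
  step-cong es {Q} {Q′} Q≗Q′ v = T-⇔→≡ (mk⇔ (step-mono {es} {Q} {Q′} (λ {x} → subst T (Q≗Q′ x)))
                                            (step-mono {es} {Q′} {Q} (λ {x} → subst T (sym (Q≗Q′ x)))))

  step-fixed⇒Path-closed : ∀ {es Q} → step es Q ≗ Q → ∀ {x y} → T (Q x) → Path es x y → T (Q y)
  step-fixed⇒Path-closed fixed Qx ε         = Qx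
  step-fixed⇒Path-closed fixed Qx (adj ◅ p) =
    step-fixed⇒Path-closed fixed (subst T (fixed _) (step-adjacent Qx adj)) p

  iter-step⇒Path : ∀ es (u : Fin n) k {v} → T (iter k (step es) (u ==_) v) → Path es u v
  iter-step⇒Path es u zero    t with refl ← ==⇒≡ t = ε
  iter-step⇒Path es u (suc k) t with step-source t
  ... | inj₁ earlier        = iter-step⇒Path es u k earlier
  ... | inj₂ (x , ux , adj) = iter-step⇒Path es u k ux ◅◅ (adj ◅ ε)

  reach⇒Path : ∀ es {u v : Fin n} → T (reach es u v) → Path es u v
  reach⇒Path es {u} = iter-step⇒Path es u n

  Path⇒reach : ∀ es {u v : Fin n} → Path es u v → T (reach es u v)
  Path⇒reach es {u} = step-fixed⇒Path-closed reach-fixed (iter-inflationary (u ==_) n (==-refl u))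
    where
    open Closure (step es) (step-inflationary es) (step-cong es)
    reach-fixed : step es (reach es u) ≗ reach es u
    reach-fixed = iter-fixed (u ==_) (filter-some (T? ∘ (u ==_)) (lose (∈-allFin u) (==-refl u)))

  Least : List (Edge n) → Fin n → Set
  Least es v = ∀ u → toℕ u < toℕ v → ¬ Path es v u

  isRep⇒Least : ∀ es {v} → T (isRep es v) → Least es v
  isRep⇒Least es {v} rep u u<v v⇝u =
    subst T (to T-not-≡ (All.lookup (all⁺ _ (allFin n) rep) (∈-allFin u)))
            (from T-∧ (fromWitness u<v , Path⇒reach es v⇝u))

  Least⇒isRep : ∀ es {v} → Least es v → T (isRep es v)
  Least⇒isRep es {v} least = all⁻ (λ u → not (⌊ toℕ u ℕ.<? toℕ v ⌋ ∧ reach es v u)) {allFin n}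
    (All.tabulate λ {u} _ → ¬T⇒T-not λ t →
      let u<v , reach-vu = to T-∧ t in least u (toWitness u<v) (reach⇒Path es reach-vu))

  ¬isRep⇒below : ∀ es {v} → ¬ T (isRep es v) → ∃[ u ] toℕ u < toℕ v × Path es v u
  ¬isRep⇒below es {v} ¬rep
    with u , _ , hit ← ¬all⇒∃ _ (allFin n) ¬rep
    with u<v , reach-vu ← to T-∧ (¬T-not⇒T hit)
    = u , toWitness u<v , reach⇒Path es reach-vu

  Least-≤ : ∀ {es v x} → Least es v → Path es v x → toℕ v ≤ toℕ x
  Least-≤ {x = x} least v⇝x = ℕ.≮⇒≥ (λ x<v → least x x<v v⇝x)

  Least-unique : ∀ {es v w} → Least es v → Least es w → Path es v w → v ≡ w
  Least-unique least-v least-w v⇝w =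
    toℕ-injective (ℕ.≤-antisym (Least-≤ least-v v⇝w) (Least-≤ least-w (Path-sym v⇝w)))

  Adjacent-∷⁻ : ∀ {a b es x z} → Adjacent ((a , b) ∷ es) x z →
                Adjacent es x z ⊎ (x ≡ a × z ≡ b) ⊎ (x ≡ b × z ≡ a)
  Adjacent-∷⁻ (inj₁ (here refl))   = inj₂ (inj₁ (refl , refl))
  Adjacent-∷⁻ (inj₂ (here refl))   = inj₂ (inj₂ (refl , refl))
  Adjacent-∷⁻ (inj₁ (there xz∈es)) = inj₁ (inj₁ xz∈es)
  Adjacent-∷⁻ (inj₂ (there zx∈es)) = inj₁ (inj₂ zx∈es)

  -- a path through the new edge a—b is cut at its first and last use of that edge
  Path-∷⁻ : ∀ {a b es x y} → Path ((a , b) ∷ es) x y →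
            Path es x y ⊎ (Path es x a × Path es b y) ⊎ (Path es x b × Path es a y)
  Path-∷⁻ ε = inj₁ ε
  Path-∷⁻ (adj ◅ z⇝y) with Adjacent-∷⁻ adj | Path-∷⁻ z⇝y
  ... | inj₁ adj′                 | inj₁ zy               = inj₁ (adj′ ◅ zy)
  ... | inj₁ adj′                 | inj₂ (inj₁ (za , by)) = inj₂ (inj₁ (adj′ ◅ za , by))
  ... | inj₁ adj′                 | inj₂ (inj₂ (zb , ay)) = inj₂ (inj₂ (adj′ ◅ zb , ay))
  ... | inj₂ (inj₁ (refl , refl)) | inj₁ by              = inj₂ (inj₁ (ε , by))
  ... | inj₂ (inj₁ (refl , refl)) | inj₂ (inj₁ (_ , by)) = inj₂ (inj₁ (ε , by))
  ... | inj₂ (inj₁ (refl , refl)) | inj₂ (inj₂ (_ , ay)) = inj₁ ay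
  ... | inj₂ (inj₂ (refl , refl)) | inj₁ ay              = inj₂ (inj₂ (ε , ay))
  ... | inj₂ (inj₂ (refl , refl)) | inj₂ (inj₁ (_ , by)) = inj₁ by
  ... | inj₂ (inj₂ (refl , refl)) | inj₂ (inj₂ (_ , ay)) = inj₂ (inj₂ (ε , ay))

  -- v is least in the component of a, which the edge a—b joins to a component with a smaller vertex
  Below : List (Edge n) → Fin n → Fin n → Fin n → Set
  Below es a b v = ∃[ u ] toℕ u < toℕ v × Path es v a × Path es b u

  Least-∷-lost : ∀ {a b es u v} → Least es v → toℕ u < toℕ v → Path ((a , b) ∷ es) v u →
                 Below es a b v ⊎ Below es b a v
  Least-∷-lost {u = u} least u<v v⇝u with Path-∷⁻ v⇝u
  ... | inj₁ v⇝u′             = contradiction v⇝u′ (least u u<v)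
  ... | inj₂ (inj₁ (va , bu)) = inj₁ (u , u<v , va , bu)
  ... | inj₂ (inj₂ (vb , au)) = inj₂ (u , u<v , vb , au)

  Below-same : ∀ {es a b v w} → Least es v → Least es w → Below es a b v → Below es a b w → v ≡ w
  Below-same least-v least-w (_ , _ , va , _) (_ , _ , wa , _) =
    Least-unique least-v least-w (va ◅◅ Path-sym wa)

  Below-opposite : ∀ {es a b v w} → Least es v → Least es w → Below es a b v → ¬ Below es b a w
  Below-opposite least-v least-w (u , u<v , va , bu) (u′ , u′<w , wb , au′) =
    ℕ.<-irrefl refl (ℕ.≤-<-trans (Least-≤ least-w (wb ◅◅ bu))
                    (ℕ.<-trans u<v (ℕ.≤-<-trans (Least-≤ least-v (va ◅◅ au′)) u′<w)))

  κ-∷ : ∀ e es → κ es ≤ suc (κ (e ∷ es))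
  κ-∷ (a , b) es = count-≤-suc (isRep ((a , b) ∷ es)) (isRep es) (allFin⁺ n) lost-unique
    where
    lost : ∀ {v} → T (isRep es v) → ¬ T (isRep ((a , b) ∷ es) v) → Below es a b v ⊎ Below es b a v
    lost rep ¬rep′ =
      let _ , u<v , v⇝u = ¬isRep⇒below _ ¬rep′ in Least-∷-lost (isRep⇒Least es rep) u<v v⇝u
    lost-unique : ∀ {v w} → T (isRep es v) → ¬ T (isRep ((a , b) ∷ es) v) →
                  T (isRep es w) → ¬ T (isRep ((a , b) ∷ es) w) → v ≡ w
    lost-unique rep-v ¬rep′-v rep-w ¬rep′-w
      with least-v ← isRep⇒Least es rep-v | least-w ← isRep⇒Least es rep-w
      with lost rep-v ¬rep′-v | lost rep-w ¬rep′-w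
    ... | inj₁ below-v | inj₁ below-w = Below-same least-v least-w below-v below-w
    ... | inj₂ below-v | inj₂ below-w = Below-same least-v least-w below-v below-w
    ... | inj₁ below-v | inj₂ below-w = contradiction below-w (Below-opposite least-v least-w below-v)
    ... | inj₂ below-v | inj₁ below-w = contradiction below-w (Below-opposite least-v least-w below-v)

  κ-[] : κ {n} [] ≡ n
  κ-[] = trans (cong length (filter-all (T? ∘ isRep []) {allFin n} all-least)) (length-tabulate id)
    where
    isolated : ∀ {v} → Least [] v
    isolated u u<v v⇝u = ℕ.<⇒≢ u<v (cong toℕ (sym (Path-[] v⇝u)))
    all-least : All (T ∘ isRep []) (allFin n)
    all-least = All.tabulate λ {v} _ → Least⇒isRep [] (isolated {v})

  n≤edges+κ : ∀ es → n ≤ length es + κ es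
  n≤edges+κ []       = ℕ.≤-reflexive (sym κ-[])
  n≤edges+κ (e ∷ es) = begin
    n                             ≤⟨ n≤edges+κ es ⟩
    length es + κ es              ≤⟨ ℕ.+-monoʳ-≤ (length es) (κ-∷ e es) ⟩
    length es + suc (κ (e ∷ es))  ≡⟨ ℕ.+-suc (length es) _ ⟩
    length (e ∷ es) + κ (e ∷ es)  ∎
    where open ℕ.≤-Reasoning

  κ≤n : ∀ es → κ es ≤ n
  κ≤n es = size≤n (isRep es)

  κ-pos : ∀ es → 0 < n → 0 < κ es
  κ-pos es 0<n = filter-some (T? ∘ isRep es) (lose (∈-allFin v₀) (Least⇒isRep es nothing-below))
    where
    v₀ = Fin.fromℕ< 0<n
    nothing-below : Least es v₀
    nothing-below u u<v₀ = contradiction (subst (toℕ u <_) (toℕ-fromℕ< 0<n) u<v₀) ℕ.n≮0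

-- Coefficients of the Whitney polynomial

iter-suc : ∀ k (f : A → A) a → iter (suc k) f a ≡ iter k f (f a)
iter-suc zero    f a = refl
iter-suc (suc k) f a = cong f (iter-suc k f a)

iter-∂x-at-0 : ∀ s p b → iter s ∂x p 0 b ≡ s ! * p s b
iter-∂x-at-0 zero    p b = sym (ℕ.+-identityʳ (p 0 b))
iter-∂x-at-0 (suc s) p b = begin
  iter (suc s) ∂x p 0 b         ≡⟨ cong (λ q → q 0 b) (iter-suc s ∂x p) ⟩
  iter s ∂x (∂x p) 0 b          ≡⟨ iter-∂x-at-0 s (∂x p) b ⟩
  s ! * (suc s * p (suc s) b)   ≡⟨ ℕ.*-assoc (s !) (suc s) _ ⟨
  s ! * suc s * p (suc s) b     ≡⟨ cong (_* p (suc s) b) (ℕ.*-comm (s !) (suc s)) ⟩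
  suc s ! * p (suc s) b         ∎
  where open ≡-Reasoning

iter-∂y-at-0 : ∀ t p a → iter t ∂y p a 0 ≡ t ! * p a t
iter-∂y-at-0 zero    p a = sym (ℕ.+-identityʳ (p a 0))
iter-∂y-at-0 (suc t) p a = begin
  iter (suc t) ∂y p a 0         ≡⟨ cong (λ q → q a 0) (iter-suc t ∂y p) ⟩
  iter t ∂y (∂y p) a 0          ≡⟨ iter-∂y-at-0 t (∂y p) a ⟩
  t ! * (suc t * p a (suc t))   ≡⟨ ℕ.*-assoc (t !) (suc t) _ ⟨
  t ! * suc t * p a (suc t)     ≡⟨ cong (_* p a (suc t)) (ℕ.*-comm (t !) (suc t)) ⟩
  suc t ! * p a (suc t)         ∎
  where open ≡-Reasoning

at00-∂xy : ∀ s t p → at00 (∂xy s t p) ≡ s ! * t ! * p s t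
at00-∂xy s t p = begin
  iter s ∂x (iter t ∂y p) 0 0   ≡⟨ iter-∂x-at-0 s (iter t ∂y p) 0 ⟩
  s ! * iter t ∂y p s 0         ≡⟨ cong (s ! *_) (iter-∂y-at-0 t p s) ⟩
  s ! * (t ! * p s t)           ≡⟨ ℕ.*-assoc (s !) (t !) _ ⟨
  s ! * t ! * p s t             ∎
  where open ≡-Reasoning

[d*c]/d≡c/1 : ∀ d c .{{_ : NonZero d}} → (+ (d * c)) / d ≡ (+ c) / 1
[d*c]/d≡c/1 (suc d) c = ℚ.fromℚᵘ-cong {mkℚᵘ (+ (suc d * c)) d} {mkℚᵘ (+ c) 0} (*≡* (begin
  + (suc d * c) ℤ.* + 1   ≡⟨ ℤ.*-identityʳ _ ⟩
  + (suc d * c)           ≡⟨ ℤ.pos-* (suc d) c ⟩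
  + suc d ℤ.* + c         ≡⟨ ℤ.*-comm (+ suc d) (+ c) ⟩
  + c ℤ.* + suc d         ∎))
  where open ≡-Reasoning

divFact-at00-∂xy : ∀ s t p → divFact (at00 (∂xy s t p)) s t ≡ (+ p s t) / 1
divFact-at00-∂xy s t p = trans (ℚ./-cong (cong +_ (at00-∂xy s t p)) refl) ([d*c]/d≡c/1 (s ! * t !) (p s t))
  where
  instance
    s!t!≢0 : NonZero (s ! * t !)
    s!t!≢0 = ℕ._!*_!≢0 s t

/1-+ : ∀ a b → (+ a) / 1 ℚ.+ (+ b) / 1 ≡ (+ (a + b)) / 1
/1-+ a b = begin
  (+ a) / 1 ℚ.+ (+ b) / 1                                    ≡⟨ cong₂ ℚ._+_ (/1≡mkℚ a) (/1≡mkℚ b) ⟩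
  ℚ.mkℚ (+ a) 0 (coprime₁ a) ℚ.+ ℚ.mkℚ (+ b) 0 (coprime₁ b)  ≡⟨ ℚ./-cong numerator refl ⟩
  (+ (a + b)) / 1                                            ∎
  where
  open ≡-Reasoning
  coprime₁ : ∀ a → Coprime.Coprime a 1
  coprime₁ a = Coprime.sym (Coprime.1-coprimeTo a)
  /1≡mkℚ : ∀ a → (+ a) / 1 ≡ ℚ.mkℚ (+ a) 0 (coprime₁ a)
  /1≡mkℚ a = ℚ.normalize-coprime (coprime₁ a)
  numerator : + a ℤ.* + 1 ℤ.+ + b ℤ.* + 1 ≡ + (a + b)
  numerator = cong₂ ℤ._+_ (ℤ.*-identityʳ (+ a)) (ℤ.*-identityʳ (+ b))

Σℚ-fromℕ : ∀ a b {f : ℕ → ℚ} {g : ℕ → ℕ} → (∀ j → f j ≡ (+ g j) / 1) →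
           Σℚ[ a ≤j≤ b ] f ≡ (+ sum (map g (range a b))) / 1
Σℚ-fromℕ a b {f} {g} f≡g = go (range a b)
  where
  go : ∀ js → foldr (λ j acc → f j ℚ.+ acc) 0ℚ js ≡ (+ sum (map g js)) / 1
  go []       = refl
  go (j ∷ js) = trans (cong₂ ℚ._+_ (f≡g j) (go js)) (/1-+ (g j) (sum (map g js)))

foldr-⊕-apply : ∀ (f : A → Poly) xs a b →
                foldr (λ x acc → f x ⊕ acc) 0P xs a b ≡ sum (map (λ x → f x a b) xs)
foldr-⊕-apply f []       a b = refl
foldr-⊕-apply f (x ∷ xs) a b = cong (_+_ (f x a b)) (foldr-⊕-apply f xs a b)

mono-coefficient : ∀ i j a b → mono i j a b ≡ ind (⌊ i ≟ a ⌋ ∧ ⌊ j ≟ b ⌋)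
mono-coefficient i j a b with ⌊ i ≟ a ⌋ ∧ ⌊ j ≟ b ⌋
... | true  = refl
... | false = refl

mono-diagonal : ∀ i j → mono i j i j ≡ 1
mono-diagonal i j = trans (mono-coefficient i j i j)
  (cong₂ (λ x y → ind (x ∧ y)) (⌊⌋-true (i ≟ i) refl) (⌊⌋-true (j ≟ j) refl))

mono-off-diagonal : ∀ {i j a b} → ¬ (i ≡ a × j ≡ b) → mono i j a b ≡ 0
mono-off-diagonal {i} {j} {a} {b} off = trans (mono-coefficient i j a b) (off-diagonal (i ≟ a) (j ≟ b))
  where
  off-diagonal : (i? : Dec (i ≡ a)) (j? : Dec (j ≡ b)) → ind (⌊ i? ⌋ ∧ ⌊ j? ⌋) ≡ 0
  off-diagonal (yes i≡a) (yes j≡b) = contradiction (i≡a , j≡b) off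
  off-diagonal (yes _)   (no _)    = refl
  off-diagonal (no _)    _         = refl

[n∸1]∸[n∸c]≡c∸1 : ∀ {n c} → c ≤ n → (n ∸ 1) ∸ (n ∸ c) ≡ c ∸ 1
[n∸1]∸[n∸c]≡c∸1 {n} {c} c≤n = begin
  (n ∸ 1) ∸ (n ∸ c)   ≡⟨ ℕ.∸-+-assoc n 1 (n ∸ c) ⟩
  n ∸ (1 + (n ∸ c))   ≡⟨ cong (n ∸_) (ℕ.+-comm 1 (n ∸ c)) ⟩
  n ∸ ((n ∸ c) + 1)   ≡⟨ ℕ.∸-+-assoc n (n ∸ c) 1 ⟨
  (n ∸ (n ∸ c)) ∸ 1   ≡⟨ cong (_∸ 1) (ℕ.m∸[m∸n]≡n c≤n) ⟩
  c ∸ 1               ∎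
  where open ≡-Reasoning

whitney-coefficient : ∀ {n} (G : Graph n) → Connected G → ∀ a b →
  whitney G a b ≡ sum (map (λ H → mono (κ H ∸ 1) (length H + κ H ∸ n) a b) (spanning G))
whitney-coefficient {n} G connected a b =
  trans (foldr-⊕-apply _ (spanning G) a b) (cong sum (map-cong rank-drop (spanning G)))
  where
  open ≡-Reasoning
  rank-drop : ∀ H → mono (rank (edges G) ∸ rank H) (corank H) a b ≡ mono (κ H ∸ 1) (corank H) a b
  rank-drop H = cong (λ e → mono e (corank H) a b) (begin
    (n ∸ κ (edges G)) ∸ (n ∸ κ H)  ≡⟨ cong (λ c → (n ∸ c) ∸ (n ∸ κ H)) connected ⟩
    (n ∸ 1) ∸ (n ∸ κ H)            ≡⟨ [n∸1]∸[n∸c]≡c∸1 (κ≤n H) ⟩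
    κ H ∸ 1                        ∎)

-- Spanning subgraphs counted by the Whitney polynomial

exponents-injective : ∀ {n L c i j} → 1 ≤ c → 1 ≤ j → n ≤ L + c → n ≤ i + j →
                      c ∸ 1 ≡ j ∸ 1 → L + c ∸ n ≡ i + j ∸ n → c ≡ j × L ≡ i
exponents-injective 1≤c 1≤j n≤L+c n≤i+j e₁ e₂ with refl ← ℕ.∸-cancelʳ-≡ 1≤c 1≤j e₁ =
  refl , ℕ.+-cancelʳ-≡ _ _ _ (ℕ.∸-cancelʳ-≡ n≤L+c n≤i+j e₂)

range-bounds : ∀ {n i k j} → j ∈ range (1 ⊔ (n ∸ i)) k → 1 ≤ j × n ≤ i + j
range-bounds {n} {i} j∈R with lo≤j , _ ← ∈-range⁻ j∈R =
  ℕ.≤-trans (ℕ.m≤m⊔n 1 (n ∸ i)) lo≤j ,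
  ℕ.≤-trans (ℕ.m≤n+m∸n n i) (ℕ.+-monoʳ-≤ i (ℕ.≤-trans (ℕ.m≤n⊔m 1 (n ∸ i)) lo≤j))

monomial-vanishes : ∀ {n L c i k j} → 1 ≤ c → n ≤ L + c → j ∈ range (1 ⊔ (n ∸ i)) k →
                    ¬ (c ≡ j × L ≡ i) → mono (c ∸ 1) (L + c ∸ n) (j ∸ 1) (i + j ∸ n) ≡ 0
monomial-vanishes 1≤c n≤L+c j∈R ¬c≡j×L≡i with 1≤j , n≤i+j ← range-bounds j∈R =
  mono-off-diagonal λ (e₁ , e₂) → ¬c≡j×L≡i (exponents-injective 1≤c 1≤j n≤L+c n≤i+j e₁ e₂)

-- For a spanning subgraph with L edges and c components, exactly the j = c term can be nonzero.
indicator-as-monomial-sum : ∀ {n L c} i k → 1 ≤ c → n ≤ L + c →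
  ind (⌊ L ≟ i ⌋ ∧ ⌊ c ≤? k ⌋) ≡
  sum (map (λ j → mono (c ∸ 1) (L + c ∸ n) (j ∸ 1) (i + j ∸ n)) (range (1 ⊔ (n ∸ i)) k))
indicator-as-monomial-sum {n} {L} {c} i k 1≤c n≤L+c with L ≟ i
... | no L≢i   = sym (sum-map-zero λ j∈R → monomial-vanishes 1≤c n≤L+c j∈R (L≢i ∘ proj₂))
... | yes refl = begin
  ind ⌊ c ≤? k ⌋                                                ≡⟨ cong ind (⌊⌋-⇔ (c ≤? k) (c ∈? R) c≤k⇔c∈R) ⟩
  ind ⌊ c ∈? R ⌋                                                ≡⟨ sum-map-≟ c range-unique ⟨
  sum (map (λ j → ind ⌊ c ≟ j ⌋) R)                             ≡⟨ sum-map-cong-∈ term ⟩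
  sum (map (λ j → mono (c ∸ 1) (L + c ∸ n) (j ∸ 1) (L + j ∸ n)) R)  ∎
  where
  open ≡-Reasoning
  R = range (1 ⊔ (n ∸ L)) k
  lo≤c : 1 ⊔ (n ∸ L) ≤ c
  lo≤c = ℕ.⊔-lub 1≤c (ℕ.m≤n+o⇒m∸n≤o n L n≤L+c)
  c≤k⇔c∈R : c ≤ k ⇔ c ∈ R
  c≤k⇔c∈R = mk⇔ (∈-range⁺ lo≤c) (proj₂ ∘ ∈-range⁻)
  term : ∀ {j} → j ∈ R → ind ⌊ c ≟ j ⌋ ≡ mono (c ∸ 1) (L + c ∸ n) (j ∸ 1) (L + j ∸ n)
  term {j} j∈R with c ≟ j
  ... | yes refl = sym (mono-diagonal (j ∸ 1) (L + j ∸ n))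
  ... | no c≢j   = sym (monomial-vanishes 1≤c n≤L+c j∈R (c≢j ∘ proj₁))

N-as-Whitney-sum : ∀ {n} (G : Graph n) → Connected G → ∀ i k →
  N i k G ≡ sum (map (λ j → whitney G (j ∸ 1) (i + j ∸ n)) (range (1 ⊔ (n ∸ i)) k))
N-as-Whitney-sum {n} G connected i k = begin
  N i k G                                                      ≡⟨ count-as-sum _ S ⟩
  sum (map (λ H → ind (⌊ length H ≟ i ⌋ ∧ ⌊ κ H ≤? k ⌋)) S)   ≡⟨ cong sum (map-cong per-subgraph S) ⟩
  sum (map (λ H → sum (map (term H) R)) S)                     ≡⟨ sum-map-swap term S R ⟩
  sum (map (λ j → sum (map (λ H → term H j) S)) R)             ≡⟨ cong sum (map-cong coefficient R) ⟨
  sum (map (λ j → whitney G (j ∸ 1) (i + j ∸ n)) R)            ∎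
  where
  open ≡-Reasoning
  S = spanning G
  R = range (1 ⊔ (n ∸ i)) k
  term : List (Edge n) → ℕ → ℕ
  term H j = mono (κ H ∸ 1) (length H + κ H ∸ n) (j ∸ 1) (i + j ∸ n)
  0<n : 0 < n
  0<n = subst (_≤ n) connected (κ≤n (edges G))
  per-subgraph : ∀ H → ind (⌊ length H ≟ i ⌋ ∧ ⌊ κ H ≤? k ⌋) ≡ sum (map (term H) R)
  per-subgraph H = indicator-as-monomial-sum i k (κ-pos H 0<n) (n≤edges+κ H)
  coefficient : ∀ j → whitney G (j ∸ 1) (i + j ∸ n) ≡ sum (map (λ H → term H j) S)
  coefficient j = whitney-coefficient G connected (j ∸ 1) (i + j ∸ n)

lemma2 : (n m : ℕ) (G : Graph n) → InC n m G →
         (k i : ℕ) → 1 ≤ k → k ≤ n → i ≤ m →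
         (+ N i k G) / 1 ≡ rhs n i k G
lemma2 n m G (connected , _) k i _ _ _ = begin
  (+ N i k G) / 1                   ≡⟨ cong (λ c → (+ c) / 1) (N-as-Whitney-sum G connected i k) ⟩
  (+ sum (map W (range lo k))) / 1  ≡⟨ Σℚ-fromℕ lo k taylor ⟨
  rhs n i k G                       ∎
  where
  open ≡-Reasoning
  lo = 1 ⊔ (n ∸ i)
  W : ℕ → ℕ
  W j = whitney G (j ∸ 1) (i + j ∸ n)
  taylor : ∀ j → divFact (at00 (∂xy (j ∸ 1) (i + j ∸ n) (whitney G))) (j ∸ 1) (i + j ∸ n) ≡ (+ W j) / 1
  taylor j = divFact-at00-∂xy (j ∸ 1) (i + j ∸ n) (whitney G)
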